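{- There do not exist integers $r,s$ with $1\le s<r$, $\gcd(r,s)=1$, and a Fano polygon $P$ such that $\mathrm{SC}(P) = \left( 0, \left\{ 5 \times \frac{1}{r}(1,s) \right\} \right)$.
   Context: Work in $N=\mathbb{Z}^2$. A Fano polygon is a convex lattice polygon containing the origin in its interior whose vertices are primitive lattice points. A two-dimensional cone with primitive ray generators is $\mathrm{GL}_2(\mathbb{Z})$-equivalent to the cone spanned by $(0,1),(r,-s)$ with $0\le s<r$, $\gcd(r,s)=1$, and then represents the cyclic quotient singularity $\frac1r(1,s)$; $\frac1r(1,s)\cong\frac1r(1,s')$ iff $s'=s$ or $ss'\equiv1\pmod r$. With $\ell(C)$ the lattice length of the segment joining the ray generators and $h(C)$ its lattice distance from the origin, $C$ is a T-cone if $h\mid\ell$ and an R-cone if $\ell<h$. Writing $\ell=nh+\rho$ ($n\ge0$, $0\le\rho<h$), $C$ subdivides into $n$ T-cones and (if $\rho>0$) one R-cone giving the residual singularity. The singularity content $\mathrm{SC}(P)$ is $(\sum n_i,\mathcal B)$ over the cones over the edges of $P$, with $\mathcal B$ the cyclically ordered list of residual singularities; $\{k\times\frac1r(1,s)\}$ denotes $k$ copies of $\frac1r(1,s)$. -}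

module Defs where

open import Data.Nat as ℕ using (ℕ; zero; suc)
open import Data.Nat.DivMod using (_/_; _%_)
open import Data.Nat.GCD using (gcd)
open import Data.Integer as ℤ using (ℤ; +_; -_; ∣_∣; _-_; _+_; _*_; +0)
open import Data.Product using (_×_; _,_; Σ; ∃; ∃-syntax)
open import Data.Sum using (_⊎_)
open import Data.List using (List; []; _∷_; _++_; [_]; length; zipWith; map)
open import Data.Nat.ListAction using (sum)
open import Data.List.Relation.Unary.All using (All)
open import Data.List.Relation.Unary.Unique.Propositional using (Unique)
open import Data.List.Membership.Propositional using (_∈_)
open import Relation.Binary.PropositionalEquality using (_≡_; _≢_)

V : Set
V = ℤ × ℤ

_⊖_ : V → V → V
(a , b) ⊖ (c , d) = (a - c , b - d)

det : V → V → ℤ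
det (a , b) (c , d) = a * d - b * c

Primitive : V → Set
Primitive (a , b) = gcd ∣ a ∣ ∣ b ∣ ≡ 1

-- Polygons given by their vertex list in counter-clockwise cyclic order.

edges : List V → List (V × V)
edges []       = []
edges (v ∷ vs) = zipWith _,_ (v ∷ vs) (vs ++ [ v ])

OthersStrictlyLeft : List V → V × V → Set
OthersStrictlyLeft vs (u , w) =
  ∀ z → z ∈ vs → z ≢ u → z ≢ w → ℤ.+0 ℤ.< det (w ⊖ u) (z ⊖ u)

OriginStrictlyLeft : V × V → Set
OriginStrictlyLeft (u , w) = ℤ.+0 ℤ.< det u w

record IsFano (vs : List V) : Set where
  field
    atLeast3      : 3 ℕ.≤ length vs
    distinct      : Unique vs
    primitiveVerts : All Primitive vs
    convex        : All (OthersStrictlyLeft vs) (edges vs)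
    originInside  : All OriginStrictlyLeft (edges vs)

record Mat : Set where
  constructor mat
  field m₁₁ m₁₂ m₂₁ m₂₂ : ℤ

_·_ : Mat → V → V
mat a b c d · (x , y) = (a * x + b * y , c * x + d * y)

InGL2 : Mat → Set
InGL2 (mat a b c d) = (a * d - b * c ≡ ℤ.+ 1) ⊎ (a * d - b * c ≡ ℤ.- ℤ.+ 1)

SameRay : V → V → Set
SameRay (x₁ , x₂) (y₁ , y₂) =
  Σ ℕ λ k → 0 ℕ.< k × (x₁ ≡ + k * y₁) × (x₂ ≡ + k * y₂)

-- The cone spanned by the (nonzero) vectors a , b is GL₂(ℤ)-equivalent
-- to the cone spanned by (0,1),(r,-s), i.e. represents 1/r(1,s).
Represents : V → V → ℕ → ℕ → Set
Represents a b r s =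
  Σ Mat λ M → InGL2 M ×
    ((SameRay (M · a) (+0 , + 1) × SameRay (M · b) (+ r , - (+ s)))
     ⊎ (SameRay (M · a) (+ r , - (+ s)) × SameRay (M · b) (+0 , + 1)))

-- truncated division / remainder (divisor 0 only arises for degenerate
-- input and never for Fano polygons)
_div′_ : ℕ → ℕ → ℕ
a div′ zero  = 0
a div′ suc k = a / suc k

_mod′_ : ℕ → ℕ → ℕ
a mod′ zero  = a
a mod′ suc k = a % suc k

module _ (e : V × V) where
  private
    u = Data.Product.proj₁ e
    w = Data.Product.proj₂ e
    d = w ⊖ u

  edgeLength : ℕ
  edgeLength = gcd ∣ Data.Product.proj₁ d ∣ ∣ Data.Product.proj₂ d ∣

  edgeHeight : ℕ
  edgeHeight = ∣ det u w ∣ div′ edgeLength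

  -- ℓ = n h + ρ
  numT : ℕ
  numT = edgeLength div′ edgeHeight

  residue : ℕ
  residue = edgeLength mod′ edgeHeight

  -- the residual R-cone: spanned by u and u + ρ·(d/ℓ), i.e. by u and the
  -- positive multiple ℓ·u + ρ·d of the latter
  residualCone : V × V
  residualCone =
    (u , ((+ edgeLength * Data.Product.proj₁ u + + residue * Data.Product.proj₁ d)
         , (+ edgeLength * Data.Product.proj₂ u + + residue * Data.Product.proj₂ d)))

basketOf : List (V × V) → List (V × V)
basketOf [] = []
basketOf (e ∷ es) with residue e
... | zero  = basketOf es
... | suc _ = residualCone e ∷ basketOf es

SC : List V → ℕ × List (V × V)
SC vs = (sum (map numT (edges vs)) , basketOf (edges vs))

CopiesOf : ℕ → ℕ → ℕ → List (V × V) → Set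
CopiesOf k r s B = length B ≡ k × All (λ c → Represents (Data.Product.proj₁ c) (Data.Product.proj₂ c) r s) B

-- Without T-cones every edge cone of P is its own residual cone, so P is a pentagon with
-- vertices v₀, …, v₄ and det (vᵢ , vᵢ₊₁) = r for every edge. Hence vᵢ + vᵢ₊₂ = aᵢ vᵢ₊₁, where
-- the aᵢ are integers because vᵢ₊₁ is primitive. The Plücker relation among four consecutive
-- vertices gives the frieze relations aᵢ₊₃ + aᵢ aᵢ₊₁ = 1, and convexity gives aᵢ ≤ 1 and
-- aᵢ₊₁ + aᵢ₊₃ ≥ 0; together these force some aᵢ = 0 and a₀ + ⋯ + a₄ = 3. Modulo r, an edge of
-- type 1/r(1,s) contributes -s and -s⁻¹ to the entries aᵢ at its two ends. A vanishing entry
-- then forces s² ≡ -1, after which every edge contributes -(s + s⁻¹) ≡ 0, so r divides 3;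
-- but no 1 ≤ s < r ≤ 3 has s² ≡ -1 (mod r).

module Submission where

open import Defs
open import Data.Empty using (⊥)
open import Data.Fin as Fin using (Fin; zero; suc; #_)
open import Data.Fin.Properties using (all?)
open import Data.Integer as ℤ using (ℤ; +_; -[1+_]; +0; ∣_∣; _*_; _+_; _-_; -_)
open import Data.Integer.Divisibility.Signed
  using (divides; ∣ᵤ⇒∣; ∣⇒∣ᵤ; ∣-refl; ∣m∣n⇒∣m+n; ∣m∣n⇒∣m-n; ∣m⇒∣-m; ∣n⇒∣m*n)
  renaming (_∣_ to _∣ℤ_)
import Data.Integer.Properties as ℤ
open import Data.Integer.Tactic.RingSolver using (solve-∀)
open import Data.List using (List; []; _∷_; _++_; [_]; length; zipWith; map; lookup)
import Data.List.Properties as List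
open import Data.List.Membership.Propositional.Properties using (∈-lookup)
open import Data.List.Relation.Unary.All as All using (All; []; _∷_)
open import Data.List.Relation.Unary.AllPairs using (_∷_)
open import Data.List.Relation.Unary.Unique.Propositional using (Unique)
open import Data.Nat as ℕ using (ℕ; zero; suc; _≤_; _<_; s≤s; z≤n)
open import Data.Nat.Coprimality using (gcd≡1⇒coprime; coprime-Bézout; coprime-divisor)
open import Data.Nat.DivMod using (_/_; _%_; m≡m%n+[m/n]*n)
open import Data.Nat.Divisibility as ℕ∣ using () renaming (_∣_ to _∣ℕ_)
open import Data.Nat.GCD
  using (module Bézout; gcd; gcd[m,n]∣m; gcd[m,n]∣n; gcd[m,n]≡0⇒m≡0; gcd[m,n]≡0⇒n≡0;
         gcd-greatest; c*gcd[m,n]≡gcd[cm,cn])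
open import Data.Nat.ListAction using (sum)
import Data.Nat.Properties as ℕ
open import Data.Product using (_×_; _,_; Σ; ∃; proj₁; proj₂)
open import Data.Sum using (_⊎_; inj₁; inj₂)
open import Function using (_∘_)
open import Relation.Binary.PropositionalEquality hiding ([_])
open import Relation.Nullary using (¬_; contradiction)
open import Relation.Nullary.Decidable using (from-yes; from-no; ¬?)

open ≡-Reasoning

infix 8 _∙_
_∙_ : V → V → ℤ
(a , b) ∙ (c , d) = a * c + b * d

infixr 7 _⋆_
_⋆_ : ℤ → V → V
k ⋆ (a , b) = (k * a , k * b)

⋆-identity : ∀ v → + 1 ⋆ v ≡ v
⋆-identity (x , y) = cong₂ _,_ (ℤ.*-identityˡ x) (ℤ.*-identityˡ y)

det-self : ∀ u → det u u ≡ +0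
det-self (u₁ , u₂) = identity u₁ u₂
  where
  identity : ∀ u₁ u₂ → u₁ * u₂ - u₂ * u₁ ≡ +0
  identity = solve-∀

det-antisym : ∀ u w → det u w ≡ - det w u
det-antisym (u₁ , u₂) (w₁ , w₂) = identity u₁ u₂ w₁ w₂
  where
  identity : ∀ u₁ u₂ w₁ w₂ → u₁ * w₂ - u₂ * w₁ ≡ - (w₁ * u₂ - w₂ * u₁)
  identity = solve-∀

det-⊖ : ∀ u w z → det (w ⊖ u) (z ⊖ u) ≡ det w z + det u w + det z u
det-⊖ (u₁ , u₂) (w₁ , w₂) (z₁ , z₂) = identity u₁ u₂ w₁ w₂ z₁ z₂
  where
  identity : ∀ u₁ u₂ w₁ w₂ z₁ z₂ →
    (w₁ - u₁) * (z₂ - u₂) - (w₂ - u₂) * (z₁ - u₁)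
      ≡ (w₁ * z₂ - w₂ * z₁) + (u₁ * w₂ - u₂ * w₁) + (z₁ * u₂ - z₂ * u₁)
  identity = solve-∀

cramer : ∀ f x y z → det x z * (f ∙ y) ≡ det y z * (f ∙ x) + det x y * (f ∙ z)
cramer (f₁ , f₂) (x₁ , x₂) (y₁ , y₂) (z₁ , z₂) = identity f₁ f₂ x₁ x₂ y₁ y₂ z₁ z₂
  where
  identity : ∀ f₁ f₂ x₁ x₂ y₁ y₂ z₁ z₂ →
    (x₁ * z₂ - x₂ * z₁) * (f₁ * y₁ + f₂ * y₂)
      ≡ (y₁ * z₂ - y₂ * z₁) * (f₁ * x₁ + f₂ * x₂) + (x₁ * y₂ - x₂ * y₁) * (f₁ * z₁ + f₂ * z₂)
  identity = solve-∀

plücker : ∀ A B C E → det A B * det C E ≡ det A C * det B E + det E A * det B C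
plücker (a₁ , a₂) (b₁ , b₂) (c₁ , c₂) (e₁ , e₂) = identity a₁ a₂ b₁ b₂ c₁ c₂ e₁ e₂
  where
  identity : ∀ a₁ a₂ b₁ b₂ c₁ c₂ e₁ e₂ →
    (a₁ * b₂ - a₂ * b₁) * (c₁ * e₂ - c₂ * e₁)
      ≡ (a₁ * c₂ - a₂ * c₁) * (b₁ * e₂ - b₂ * e₁) + (e₁ * a₂ - e₂ * a₁) * (b₁ * c₂ - b₂ * c₁)
  identity = solve-∀

binet-cauchy : ∀ u w f g → (f ∙ w) * (g ∙ u) - (f ∙ u) * (g ∙ w) ≡ - (det f g * det u w)
binet-cauchy (u₁ , u₂) (w₁ , w₂) (f₁ , f₂) (g₁ , g₂) = identity f₁ f₂ g₁ g₂ u₁ u₂ w₁ w₂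
  where
  identity : ∀ f₁ f₂ g₁ g₂ u₁ u₂ w₁ w₂ →
    (f₁ * w₁ + f₂ * w₂) * (g₁ * u₁ + g₂ * u₂) - (f₁ * u₁ + f₂ * u₂) * (g₁ * w₁ + g₂ * w₂)
      ≡ - ((f₁ * g₂ - f₂ * g₁) * (u₁ * w₂ - u₂ * w₁))
  identity = solve-∀

detM : Mat → ℤ
detM (mat a b c d) = a * d - b * c

adj : Mat → Mat
adj (mat a b c d) = mat d (- b) (- c) a

adj-· : ∀ M v → adj M · (M · v) ≡ detM M ⋆ v
adj-· (mat a b c d) (x , y) = cong₂ _,_ (identity₁ a b c d x y) (identity₂ a b c d x y)
  where
  identity₁ : ∀ a b c d x y → d * (a * x + b * y) + - b * (c * x + d * y) ≡ (a * d - b * c) * x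
  identity₁ = solve-∀
  identity₂ : ∀ a b c d x y → - c * (a * x + b * y) + a * (c * x + d * y) ≡ (a * d - b * c) * y
  identity₂ = solve-∀

det-· : ∀ M u w → det (M · u) (M · w) ≡ detM M * det u w
det-· (mat a b c d) (u₁ , u₂) (w₁ , w₂) = identity a b c d u₁ u₂ w₁ w₂
  where
  identity : ∀ a b c d u₁ u₂ w₁ w₂ →
    (a * u₁ + b * u₂) * (c * w₁ + d * w₂) - (c * u₁ + d * u₂) * (a * w₁ + b * w₂)
      ≡ (a * d - b * c) * (u₁ * w₂ - u₂ * w₁)
  identity = solve-∀

·-⋆ : ∀ M k v → M · (k ⋆ v) ≡ k ⋆ (M · v)
·-⋆ (mat a b c d) k (x , y) = cong₂ _,_ (identity a b k x y) (identity c d k x y)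
  where
  identity : ∀ a b k x y → a * (k * x) + b * (k * y) ≡ k * (a * x + b * y)
  identity = solve-∀

∣det∣≡1 : ∀ {M} → InGL2 M → ∣ detM M ∣ ≡ 1
∣det∣≡1 (inj₁ δ≡1)  = cong ∣_∣ δ≡1
∣det∣≡1 (inj₂ δ≡-1) = cong ∣_∣ δ≡-1

content : V → ℕ
content (a , b) = gcd ∣ a ∣ ∣ b ∣

content-⋆ : ∀ k v → content (+ k ⋆ v) ≡ k ℕ.* content v
content-⋆ k (x , y) = begin
  gcd (∣ + k * x ∣) (∣ + k * y ∣)  ≡⟨ cong₂ gcd (ℤ.abs-* (+ k) x) (ℤ.abs-* (+ k) y) ⟩
  gcd (k ℕ.* ∣ x ∣) (k ℕ.* ∣ y ∣)  ≡⟨ c*gcd[m,n]≡gcd[cm,cn] k ∣ x ∣ ∣ y ∣ ⟨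
  k ℕ.* gcd ∣ x ∣ ∣ y ∣            ∎

content-unit-⋆ : ∀ {δ} → ∣ δ ∣ ≡ 1 → ∀ v → content (δ ⋆ v) ≡ content v
content-unit-⋆ {δ} ∣δ∣≡1 (x , y) = cong₂ gcd (abs-unit-* x) (abs-unit-* y)
  where
  abs-unit-* : ∀ z → ∣ δ * z ∣ ≡ ∣ z ∣
  abs-unit-* z = trans (ℤ.abs-* δ z) (trans (cong (ℕ._* ∣ z ∣) ∣δ∣≡1) (ℕ.*-identityˡ ∣ z ∣))

content∣content-· : ∀ M v → content v ∣ℕ content (M · v)
content∣content-· (mat a b c d) (x , y) =
  gcd-greatest (divides-combination a b) (divides-combination c d)
  where
  g = gcd ∣ x ∣ ∣ y ∣
  g∣x : + g ∣ℤ x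
  g∣x = ∣ᵤ⇒∣ (gcd[m,n]∣m ∣ x ∣ ∣ y ∣)
  g∣y : + g ∣ℤ y
  g∣y = ∣ᵤ⇒∣ (gcd[m,n]∣n ∣ x ∣ ∣ y ∣)
  divides-combination : ∀ p q → g ∣ℕ ∣ p * x + q * y ∣
  divides-combination p q = ∣⇒∣ᵤ (∣m∣n⇒∣m+n (∣n⇒∣m*n p g∣x) (∣n⇒∣m*n q g∣y))

·-primitive : ∀ {M v} → InGL2 M → Primitive v → Primitive (M · v)
·-primitive {M} {v} unimodular v-primitive =
  ℕ∣.∣1⇒≡1 (subst (content (M · v) ∣ℕ_) content≡1 (content∣content-· (adj M) (M · v)))
  where
  content≡1 : content (adj M · (M · v)) ≡ 1
  content≡1 = begin
    content (adj M · (M · v))  ≡⟨ cong content (adj-· M v) ⟩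
    content (detM M ⋆ v)       ≡⟨ content-unit-⋆ {detM M} (∣det∣≡1 {M} unimodular) v ⟩
    content v                  ≡⟨ v-primitive ⟩
    1                          ∎

⋆-cancel-primitive : ∀ {k l x y} → Primitive x → Primitive y → 0 < l → + k ⋆ x ≡ + l ⋆ y → x ≡ y
⋆-cancel-primitive {k} {suc l} {x₁ , x₂} {y₁ , y₂} x-primitive y-primitive _ eq =
  cong₂ _,_ (ℤ.*-cancelˡ-≡ (+ suc l) x₁ y₁ (trans (cong (_* x₁) (sym k≡l)) (cong proj₁ eq)))
            (ℤ.*-cancelˡ-≡ (+ suc l) x₂ y₂ (trans (cong (_* x₂) (sym k≡l)) (cong proj₂ eq)))
  where
  k≡l : + k ≡ + suc l
  k≡l = cong +_ (begin
    k                              ≡⟨ ℕ.*-identityʳ k ⟨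
    k ℕ.* 1                        ≡⟨ cong (k ℕ.*_) x-primitive ⟨
    k ℕ.* content (x₁ , x₂)        ≡⟨ content-⋆ k (x₁ , x₂) ⟨
    content (+ k ⋆ (x₁ , x₂))      ≡⟨ cong content eq ⟩
    content (+ suc l ⋆ (y₁ , y₂))  ≡⟨ content-⋆ (suc l) (y₁ , y₂) ⟩
    suc l ℕ.* content (y₁ , y₂)    ≡⟨ cong (suc l ℕ.*_) y-primitive ⟩
    suc l ℕ.* 1                    ≡⟨ ℕ.*-identityʳ (suc l) ⟩
    suc l                          ∎)

sameRay-⋆ : ∀ {x y} → SameRay x y → ∃ λ k → 0 < k × x ≡ + k ⋆ y
sameRay-⋆ (k , k>0 , eq₁ , eq₂) = k , k>0 , cong₂ _,_ eq₁ eq₂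

unimodular-ray : ∀ {M k x t} → InGL2 M → Primitive x → Primitive t →
                 SameRay (M · (+ k ⋆ x)) t → M · x ≡ t
unimodular-ray {M} {k} {x} unimodular x-primitive t-primitive ray with sameRay-⋆ ray
... | l , l>0 , eq =
  ⋆-cancel-primitive {k} {l} (·-primitive {M} unimodular x-primitive) t-primitive l>0
    (trans (sym (·-⋆ M (+ k) x)) eq)

pos-lift : ∀ {a b c d e} → a ℕ.+ b ℕ.* c ≡ d ℕ.* e → + a + + b * + c ≡ + d * + e
pos-lift {a} {b} {c} {d} {e} eq = begin
  + a + + b * + c    ≡⟨ cong (_+_ (+ a)) (ℤ.pos-* b c) ⟨
  + a + + (b ℕ.* c)  ≡⟨ ℤ.pos-+ a (b ℕ.* c) ⟨
  + (a ℕ.+ b ℕ.* c)  ≡⟨ cong +_ eq ⟩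
  + (d ℕ.* e)        ≡⟨ ℤ.pos-* d e ⟩
  + d * + e          ∎

bézout : ∀ m n → gcd m n ≡ 1 → ∃ λ x → ∃ λ y → x * + m + y * + n ≡ + 1
bézout m n coprime with coprime-Bézout (gcd≡1⇒coprime coprime)
... | Bézout.+- x y eq = + x , - + y , (begin
  + x * + m + - + y * + n        ≡⟨ cong (_+ - + y * + n) (pos-lift {1} {y} {n} {x} {m} eq) ⟨
  + 1 + + y * + n + - + y * + n  ≡⟨ cancel (+ y) (+ n) ⟩
  + 1                            ∎)
  where
  cancel : ∀ a b → + 1 + a * b + - a * b ≡ + 1
  cancel = solve-∀
... | Bézout.-+ x y eq = - + x , + y , (begin
  - + x * + m + + y * + n          ≡⟨ cong (_+_ (- + x * + m)) (pos-lift {1} {x} {m} {y} {n} eq) ⟨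
  - + x * + m + (+ 1 + + x * + m)  ≡⟨ cancel (+ x) (+ m) ⟩
  + 1                              ∎)
  where
  cancel : ∀ a b → - a * b + (+ 1 + a * b) ≡ + 1
  cancel = solve-∀

sign-multiple : ∀ i → ∃ λ σ → σ * i ≡ + ∣ i ∣
sign-multiple (+ n)    = + 1 , ℤ.*-identityˡ (+ n)
sign-multiple -[1+ n ] = - + 1 , ℤ.-1*i≡-i -[1+ n ]

primitive-dual : ∀ {v} → Primitive v → ∃ λ f → f ∙ v ≡ + 1
primitive-dual {a , b} v-primitive
  with bézout ∣ a ∣ ∣ b ∣ v-primitive | sign-multiple a | sign-multiple b
... | x , y , eq | σ , σa | τ , τb = (x * σ , y * τ) , (begin
  x * σ * a + y * τ * b      ≡⟨ cong₂ _+_ (ℤ.*-assoc x σ a) (ℤ.*-assoc y τ b) ⟩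
  x * (σ * a) + y * (τ * b)  ≡⟨ cong₂ (λ p q → x * p + y * q) σa τb ⟩
  x * + ∣ a ∣ + y * + ∣ b ∣  ≡⟨ eq ⟩
  + 1                        ∎)

-- Cones of type 1/r(1,s)

-- y is the second coordinate of a basis in which the cone over (u , w) is spanned by
-- (0 , 1) and (r , -s), in one order or the other.
record QuotientEdge (r s : ℕ) (u w : V) : Set where
  constructor quotientEdge
  field
    det≡r      : det u w ≡ + r
    y          : V
    y-standard : (y ∙ u ≡ + 1 × y ∙ w ≡ - + s) ⊎ (y ∙ w ≡ + 1 × y ∙ u ≡ - + s)

unit-*-positive : ∀ {δ D r} → ∣ δ ∣ ≡ 1 → +0 ℤ.< D → ∣ δ * D ∣ ≡ r → D ≡ + r
unit-*-positive {δ} {D} {r} ∣δ∣≡1 D>0 eq = begin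
  D                    ≡⟨ ℤ.0≤i⇒+∣i∣≡i (ℤ.<⇒≤ D>0) ⟨
  + ∣ D ∣              ≡⟨ cong +_ (ℕ.*-identityˡ ∣ D ∣) ⟨
  + (1 ℕ.* ∣ D ∣)      ≡⟨ cong (λ n → + (n ℕ.* ∣ D ∣)) ∣δ∣≡1 ⟨
  + (∣ δ ∣ ℕ.* ∣ D ∣)  ≡⟨ cong +_ (ℤ.abs-* δ D) ⟨
  + ∣ δ * D ∣          ≡⟨ cong +_ eq ⟩
  + r                  ∎

row₂ : Mat → V
row₂ (mat _ _ c d) = (c , d)

represents⇒quotientEdge : ∀ {r s ℓ u w} → gcd r s ≡ 1 → Primitive u → Primitive w → +0 ℤ.< det u w →
                          Represents u (+ ℓ ⋆ w) r s → QuotientEdge r s u w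
represents⇒quotientEdge {r} {s} {ℓ} {u} {w} coprime u-primitive w-primitive det>0
                        (M , unimodular , orientation) = standard orientation
  where
  e₂ σ : V
  e₂ = (+0 , + 1)
  σ  = (+ r , - + s)
  σ-primitive : Primitive σ
  σ-primitive = trans (cong (gcd r) (ℤ.∣-i∣≡∣i∣ (+ s))) coprime
  image-u : ∀ {t} → Primitive t → SameRay (M · u) t → M · u ≡ t
  image-u t-primitive ray = unimodular-ray {M} {1} unimodular u-primitive t-primitive
                              (subst (λ x → SameRay (M · x) _) (sym (⋆-identity u)) ray)
  image-w : ∀ {t} → Primitive t → SameRay (M · (+ ℓ ⋆ w)) t → M · w ≡ t
  image-w = unimodular-ray {M} {ℓ} unimodular w-primitive
  det≡r : ∀ {a b} → M · u ≡ a → M · w ≡ b → ∣ det a b ∣ ≡ r → det u w ≡ + r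
  det≡r Mu Mw eq = unit-*-positive {detM M} (∣det∣≡1 {M} unimodular) det>0
                     (trans (cong ∣_∣ (trans (sym (det-· M u w)) (cong₂ det Mu Mw))) eq)
  det-e₂-σ : ∀ r s → +0 * - s - + 1 * r ≡ - r
  det-e₂-σ = solve-∀
  det-σ-e₂ : ∀ r s → r * + 1 - - s * +0 ≡ r
  det-σ-e₂ = solve-∀
  standard : (SameRay (M · u) e₂ × SameRay (M · (+ ℓ ⋆ w)) σ) ⊎
             (SameRay (M · u) σ × SameRay (M · (+ ℓ ⋆ w)) e₂) → QuotientEdge r s u w
  standard (inj₁ (ray-u , ray-w)) =
    quotientEdge (det≡r Mu Mw (trans (cong ∣_∣ (det-e₂-σ (+ r) (+ s))) (ℤ.∣-i∣≡∣i∣ (+ r))))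
                 (row₂ M) (inj₁ (cong proj₂ Mu , cong proj₂ Mw))
    where
    Mu = image-u refl ray-u
    Mw = image-w σ-primitive ray-w
  standard (inj₂ (ray-u , ray-w)) =
    quotientEdge (det≡r Mu Mw (cong ∣_∣ (det-σ-e₂ (+ r) (+ s))))
                 (row₂ M) (inj₂ (cong proj₂ Mw , cong proj₂ Mu))
    where
    Mu = image-u σ-primitive ray-u
    Mw = image-w refl ray-w

minor-divisible : ∀ {r a b c d} u w f g → det u w ≡ + r →
                  f ∙ w ≡ a → g ∙ u ≡ b → f ∙ u ≡ c → g ∙ w ≡ d → + r ∣ℤ a * b - c * d
minor-divisible {r} u w f g det≡r refl refl refl refl = divides (- det f g) (begin
  (f ∙ w) * (g ∙ u) - (f ∙ u) * (g ∙ w)  ≡⟨ binet-cauchy u w f g ⟩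
  - (det f g * det u w)                  ≡⟨ cong (λ D → - (det f g * D)) det≡r ⟩
  - (det f g * + r)                      ≡⟨ ℤ.neg-distribˡ-* (det f g) (+ r) ⟩
  - det f g * + r                        ∎)

data ResiduePair (r s : ℕ) (α β : ℤ) : Set where
  forward  : + r ∣ℤ α + + s → + r ∣ℤ + s * β + + 1 → ResiduePair r s α β
  backward : + r ∣ℤ + s * α + + 1 → + r ∣ℤ β + + s → ResiduePair r s α β

quotientEdge-residues : ∀ {r s u w} f g → QuotientEdge r s u w → f ∙ u ≡ + 1 → g ∙ w ≡ + 1 →
                        ResiduePair r s (f ∙ w) (g ∙ u)
quotientEdge-residues {r} {s} {u} {w} f g (quotientEdge det≡r y (inj₁ (yu , yw))) fu gw =
  forward (subst (+ r ∣ℤ_) (identity₁ (f ∙ w) (+ s)) (minor-divisible u w f y det≡r refl yu fu yw))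
          (subst (+ r ∣ℤ_) (identity₂ (g ∙ u) (+ s)) (minor-divisible u w g y det≡r gw yu refl yw))
  where
  identity₁ : ∀ α s → α * + 1 - + 1 * - s ≡ α + s
  identity₁ = solve-∀
  identity₂ : ∀ β s → + 1 * + 1 - β * - s ≡ s * β + + 1
  identity₂ = solve-∀
quotientEdge-residues {r} {s} {u} {w} f g (quotientEdge det≡r y (inj₂ (yw , yu))) fu gw =
  backward (subst (+ r ∣ℤ_) (identity₁ (f ∙ w) (+ s))
                   (∣m⇒∣-m (minor-divisible u w f y det≡r refl yu fu yw)))
           (subst (+ r ∣ℤ_) (identity₂ (g ∙ u) (+ s))
                   (∣m⇒∣-m (minor-divisible u w g y det≡r gw yu refl yw)))
  where
  identity₁ : ∀ α s → - (α * - s - + 1 * + 1) ≡ s * α + + 1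
  identity₁ = solve-∀
  identity₂ : ∀ β s → - (+ 1 * - s - β * + 1) ≡ β + s
  identity₂ = solve-∀

residuePair-swap : ∀ {r s α β} → ResiduePair r s α β → ResiduePair r s β α
residuePair-swap (forward α+s sβ+1)  = backward sβ+1 α+s
residuePair-swap (backward sα+1 β+s) = forward β+s sα+1

residuePair-sum : ∀ {r s α β} → + r ∣ℤ + s * + s + + 1 → ResiduePair r s α β → + r ∣ℤ α + β
residuePair-sum {r} {s} {α} {β} r∣s²+1 (forward α+s sβ+1) =
  subst (+ r ∣ℤ_) (identity α β (+ s))
    (∣m∣n⇒∣m-n (∣m∣n⇒∣m+n α+s (∣n⇒∣m*n β r∣s²+1)) (∣n⇒∣m*n (+ s) sβ+1))
  where
  identity : ∀ α β s → α + s + β * (s * s + + 1) - s * (s * β + + 1) ≡ α + β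
  identity = solve-∀
residuePair-sum {r} {s} {α} {β} r∣s²+1 pair@(backward _ _) =
  subst (+ r ∣ℤ_) (ℤ.+-comm β α) (residuePair-sum r∣s²+1 (residuePair-swap pair))

r∣2⇒r∣s²+1 : ∀ {r s} → 1 ≤ s → s < r → r ∣ℕ 2 → + r ∣ℤ + s * + s + + 1
r∣2⇒r∣s²+1 {r} {s} 1≤s s<r r∣2 = subst₂ (λ r s → + r ∣ℤ + s * + s + + 1) (sym r≡2) (sym s≡1) ∣-refl
  where
  r≤2 : r ≤ 2
  r≤2 = ℕ∣.∣⇒≤ r∣2
  s≡1 : s ≡ 1
  s≡1 = ℕ.≤-antisym (ℕ.≤-pred (ℕ.≤-trans s<r r≤2)) 1≤s
  r≡2 : r ≡ 2
  r≡2 = ℕ.≤-antisym r≤2 (subst (_< r) s≡1 s<r)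

-- With β′ ≡ -α, each combination of orientations yields s² ≡ -1 or 2 ≡ 0 (mod r).
residuePairs-cancel : ∀ {r s α′ β′ α β} → 1 ≤ s → s < r → gcd r s ≡ 1 →
                      ResiduePair r s α′ β′ → ResiduePair r s α β → β′ + α ≡ +0 →
                      + r ∣ℤ + s * + s + + 1
residuePairs-cancel {r} {s} {α′} {β′} {α} {β} 1≤s s<r coprime pair′ pair β′+α≡0 = cases pair′ pair
  where
  combine : ∀ {x y z} c → + r ∣ℤ x → + r ∣ℤ y → x + y - c * (β′ + α) ≡ z → + r ∣ℤ z
  combine c r∣x r∣y eq =
    subst (+ r ∣ℤ_) eq (∣m∣n⇒∣m-n (∣m∣n⇒∣m+n r∣x r∣y) (∣n⇒∣m*n c (divides +0 β′+α≡0)))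
  cases : ResiduePair r s α′ β′ → ResiduePair r s α β → + r ∣ℤ + s * + s + + 1
  cases (forward _ sβ′+1) (forward α+s _) =
    combine (+ s) sβ′+1 (∣n⇒∣m*n (+ s) α+s) (identity β′ α (+ s))
    where
    identity : ∀ β′ α s → s * β′ + + 1 + s * (α + s) - s * (β′ + α) ≡ s * s + + 1
    identity = solve-∀
  cases (backward _ β′+s) (backward sα+1 _) =
    combine (+ s) (∣n⇒∣m*n (+ s) β′+s) sα+1 (identity β′ α (+ s))
    where
    identity : ∀ β′ α s → s * (β′ + s) + (s * α + + 1) - s * (β′ + α) ≡ s * s + + 1
    identity = solve-∀
  cases (forward _ sβ′+1) (backward sα+1 _) =
    r∣2⇒r∣s²+1 1≤s s<r (∣⇒∣ᵤ (combine (+ s) sβ′+1 sα+1 (identity β′ α (+ s))))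
    where
    identity : ∀ β′ α s → s * β′ + + 1 + (s * α + + 1) - s * (β′ + α) ≡ + 2
    identity = solve-∀
  cases (backward _ β′+s) (forward α+s _) =
    r∣2⇒r∣s²+1 1≤s s<r (coprime-divisor (gcd≡1⇒coprime coprime)
      (subst (r ∣ℕ_) (ℤ.abs-* (+ s) (+ 2)) (∣⇒∣ᵤ (combine (+ 1) β′+s α+s (identity β′ α (+ s))))))
    where
    identity : ∀ β′ α s → β′ + s + (α + s) - + 1 * (β′ + α) ≡ s * + 2
    identity = solve-∀

r∣3⇒r∤s²+1 : ∀ {r s} → 1 ≤ s → s < r → + r ∣ℤ + 3 → ¬ (+ r ∣ℤ + s * + s + + 1)
r∣3⇒r∤s²+1 {r} {s} 1≤s s<r r∣3 r∣s²+1 = excluded r s 1≤s s<r (∣⇒∣ᵤ r∣3) (∣⇒∣ᵤ r∣s²+1)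
  where
  excluded : ∀ r s → 1 ≤ s → s < r → r ∣ℕ 3 → ¬ (r ∣ℕ ∣ + s * + s + + 1 ∣)
  excluded 2 1 _ _ 2∣3 _   = from-no (2 ℕ∣.∣? 3) 2∣3
  excluded 3 1 _ _ _   3∣2 = from-no (3 ℕ∣.∣? 2) 3∣2
  excluded 3 2 _ _ _   3∣5 = from-no (3 ℕ∣.∣? 5) 3∣5
  excluded _ 0 () _ _
  excluded 1 (suc _) _ (s≤s ()) _
  excluded 2 (suc (suc _)) _ (s≤s (s≤s ())) _
  excluded 3 (suc (suc (suc _))) _ (s≤s (s≤s (s≤s ()))) _
  excluded (suc (suc (suc (suc r)))) _ _ _ r∣3 with ℕ∣.∣⇒≤ r∣3
  ... | s≤s (s≤s (s≤s ()))

-- Pentagonal friezes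

next : Fin 5 → Fin 5
next zero                         = suc zero
next (suc zero)                   = suc (suc zero)
next (suc (suc zero))             = suc (suc (suc zero))
next (suc (suc (suc zero)))       = suc (suc (suc (suc zero)))
next (suc (suc (suc (suc zero)))) = zero

next⁵ : ∀ i → next (next (next (next (next i)))) ≡ i
next⁵ zero                         = refl
next⁵ (suc zero)                   = refl
next⁵ (suc (suc zero))             = refl
next⁵ (suc (suc (suc zero)))       = refl
next⁵ (suc (suc (suc (suc zero)))) = refl

next²≢id : ∀ i → next (next i) ≢ i
next²≢id = from-yes (all? λ i → ¬? (next (next i) Fin.≟ i))

next²≢next : ∀ i → next (next i) ≢ next i
next²≢next = from-yes (all? λ i → ¬? (next (next i) Fin.≟ next i))

next³≢id : ∀ i → next (next (next i)) ≢ i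
next³≢id = from-yes (all? λ i → ¬? (next (next (next i)) Fin.≟ i))

next³≢next : ∀ i → next (next (next i)) ≢ next i
next³≢next = from-yes (all? λ i → ¬? (next (next (next i)) Fin.≟ next i))

Σ₅ : (Fin 5 → ℤ) → ℤ
Σ₅ a = a (# 0) + a (# 1) + a (# 2) + a (# 3) + a (# 4)

Σ₅-∘next : ∀ a → Σ₅ (a ∘ next) ≡ Σ₅ a
Σ₅-∘next a = identity (a (# 0)) (a (# 1)) (a (# 2)) (a (# 3)) (a (# 4))
  where
  identity : ∀ a₀ a₁ a₂ a₃ a₄ → a₁ + a₂ + a₃ + a₄ + a₀ ≡ a₀ + a₁ + a₂ + a₃ + a₄
  identity = solve-∀

Σ₅-shift : ∀ (α β : Fin 5 → ℤ) → Σ₅ (λ i → β i + α (next i)) ≡ Σ₅ (λ i → α i + β i)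
Σ₅-shift α β = identity (α (# 0)) (α (# 1)) (α (# 2)) (α (# 3)) (α (# 4))
                        (β (# 0)) (β (# 1)) (β (# 2)) (β (# 3)) (β (# 4))
  where
  identity : ∀ α₀ α₁ α₂ α₃ α₄ β₀ β₁ β₂ β₃ β₄ →
    (β₀ + α₁) + (β₁ + α₂) + (β₂ + α₃) + (β₃ + α₄) + (β₄ + α₀)
      ≡ (α₀ + β₀) + (α₁ + β₁) + (α₂ + β₂) + (α₃ + β₃) + (α₄ + β₄)
  identity = solve-∀

Σ₅-∣ : ∀ {k a} → (∀ i → k ∣ℤ a i) → k ∣ℤ Σ₅ a
Σ₅-∣ k∣a =
  ∣m∣n⇒∣m+n (∣m∣n⇒∣m+n (∣m∣n⇒∣m+n (∣m∣n⇒∣m+n (k∣a (# 0)) (k∣a (# 1))) (k∣a (# 2))) (k∣a (# 3))) (k∣a (# 4))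

Frieze : (Fin 5 → ℤ) → Set
Frieze a = ∀ i → a (next (next (next i))) + a i * a (next i) ≡ + 1

frieze-sum : ∀ {a} → Frieze a → a (# 0) ≡ +0 → Σ₅ a ≡ + 3
frieze-sum {a} frieze a₀≡0 = begin
  a₀ + a₁ + a₂ + a₃ + a₄      ≡⟨ cong₂ (λ p q → p + a₁ + q + a₃ + a₄) a₀≡0 a₂≡1 ⟩
  +0 + a₁ + + 1 + a₃ + a₄     ≡⟨ cong (λ p → +0 + a₁ + + 1 + p + a₄) a₃≡1 ⟩
  +0 + a₁ + + 1 + + 1 + a₄    ≡⟨ identity a₁ a₄ ⟩
  a₄ + a₁ * + 1 + + 2         ≡⟨ cong (λ p → a₄ + a₁ * p + + 2) a₂≡1 ⟨
  a₄ + a₁ * a₂ + + 2          ≡⟨ cong (_+ + 2) (frieze (# 1)) ⟩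
  + 3                         ∎
  where
  a₀ = a (# 0); a₁ = a (# 1); a₂ = a (# 2); a₃ = a (# 3); a₄ = a (# 4)
  identity : ∀ a₁ a₄ → +0 + a₁ + + 1 + + 1 + a₄ ≡ a₄ + a₁ * + 1 + + 2
  identity = solve-∀
  a₃≡1 : a₃ ≡ + 1
  a₃≡1 = begin
    a₃            ≡⟨ ℤ.+-identityʳ a₃ ⟨
    a₃ + +0 * a₁  ≡⟨ cong (λ p → a₃ + p * a₁) a₀≡0 ⟨
    a₃ + a₀ * a₁  ≡⟨ frieze (# 0) ⟩
    + 1           ∎
  a₂≡1 : a₂ ≡ + 1
  a₂≡1 = begin
    a₂            ≡⟨ ℤ.+-identityʳ a₂ ⟨
    a₂ + +0       ≡⟨ cong (_+_ a₂) (ℤ.*-zeroʳ a₄) ⟨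
    a₂ + a₄ * +0  ≡⟨ cong (λ p → a₂ + a₄ * p) a₀≡0 ⟨
    a₂ + a₄ * a₀  ≡⟨ frieze (# 4) ⟩
    + 1           ∎

unit-or-zero : ∀ {x y} → +0 ℤ.< + 2 - x → +0 ℤ.< + 2 - y → +0 ℤ.< x + + 1 + y →
               x ≡ - + 1 ⊎ x ≡ +0 ⊎ x ≡ + 1
unit-or-zero {+ 0}                 _ _ _ = inj₂ (inj₁ refl)
unit-or-zero {+ 1}                 _ _ _ = inj₂ (inj₂ refl)
unit-or-zero {+ suc (suc zero)}    (ℤ.+<+ ()) _ _
unit-or-zero {+ suc (suc (suc _))} () _ _
unit-or-zero { -[1+ 0 ]}           _ _ _ = inj₁ refl
unit-or-zero { -[1+ suc _ ]}       {+ 0}                 _ _ ()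
unit-or-zero { -[1+ suc zero ]}    {+ 1}                 _ _ (ℤ.+<+ ())
unit-or-zero { -[1+ suc (suc _) ]} {+ 1}                 _ _ ()
unit-or-zero { -[1+ suc _ ]}       {+ suc (suc zero)}    _ (ℤ.+<+ ()) _
unit-or-zero { -[1+ suc _ ]}       {+ suc (suc (suc _))} _ () _
unit-or-zero { -[1+ suc _ ]}       { -[1+ _ ]}           _ _ ()

a+k≡c⇒a≡c-k : ∀ {a k c} → a + k ≡ c → a ≡ c - k
a+k≡c⇒a≡c-k {a} {k} a+k≡c = trans (identity a k) (cong (_- k) a+k≡c)
  where
  identity : ∀ a k → a ≡ a + k - k
  identity = solve-∀

unit-product-zero : ∀ {a b c} → +0 ℤ.< + 2 - a → a + b * c ≡ + 1 →
                    b ≡ - + 1 ⊎ b ≡ +0 ⊎ b ≡ + 1 → c ≡ - + 1 ⊎ c ≡ +0 ⊎ c ≡ + 1 →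
                    a ≡ +0 ⊎ b ≡ +0 ⊎ c ≡ +0
unit-product-zero _ _  (inj₂ (inj₁ b≡0))  _                  = inj₂ (inj₁ b≡0)
unit-product-zero _ _  _                  (inj₂ (inj₁ c≡0))  = inj₂ (inj₂ c≡0)
unit-product-zero _ eq (inj₁ refl)        (inj₁ refl)        = inj₁ (a+k≡c⇒a≡c-k eq)
unit-product-zero _ eq (inj₂ (inj₂ refl)) (inj₂ (inj₂ refl)) = inj₁ (a+k≡c⇒a≡c-k eq)
unit-product-zero {a} 0<2-a eq (inj₁ refl) (inj₂ (inj₂ refl)) with a+k≡c⇒a≡c-k {a} { - + 1} eq
... | refl = contradiction 0<2-a (ℤ.<-irrefl refl)
unit-product-zero {a} 0<2-a eq (inj₂ (inj₂ refl)) (inj₁ refl) with a+k≡c⇒a≡c-k {a} { - + 1} eq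
... | refl = contradiction 0<2-a (ℤ.<-irrefl refl)

frieze-classification : ∀ {a} → Frieze a → (∀ i → +0 ℤ.< + 2 - a i) →
                        (∀ i → +0 ℤ.< a (next i) + + 1 + a (next (next (next i)))) →
                        Σ₅ a ≡ + 3 × ∃ λ i → a i ≡ +0
frieze-classification {a} frieze upper lower
  with unit-product-zero (upper (# 3)) (frieze (# 0))
         (unit-or-zero (upper (# 0)) (upper (# 2)) (lower (# 4)))
         (unit-or-zero (upper (# 1)) (upper (# 3)) (lower (# 0)))
... | inj₂ (inj₁ a₀≡0) = frieze-sum {a} frieze a₀≡0 , # 0 , a₀≡0
... | inj₂ (inj₂ a₁≡0) =
  trans (sym (Σ₅-∘next a)) (frieze-sum {a ∘ next} (frieze ∘ next) a₁≡0) , # 1 , a₁≡0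
... | inj₁ a₃≡0 =
  trans (sym rotate³) (frieze-sum {a ∘ next ∘ next ∘ next} (frieze ∘ next ∘ next ∘ next) a₃≡0) ,
  # 3 , a₃≡0
  where
  rotate³ : Σ₅ (a ∘ next ∘ next ∘ next) ≡ Σ₅ a
  rotate³ = trans (Σ₅-∘next (a ∘ next ∘ next)) (trans (Σ₅-∘next (a ∘ next)) (Σ₅-∘next a))

-- Pentagons whose edges are cones of type 1/r(1,s)

positive-factor : ∀ r {x y} → + r * x ≡ y → +0 ℤ.< y → +0 ℤ.< x
positive-factor r {x} r*x≡y 0<y =
  ℤ.*-cancelˡ-<-nonNeg (+ r) (subst₂ ℤ._<_ (sym (ℤ.*-zeroʳ (+ r))) (sym r*x≡y) 0<y)

module Pentagon {r s : ℕ} (1≤s : 1 ≤ s) (s<r : s < r) (coprime : gcd r s ≡ 1)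
  (v : Fin 5 → V)
  (v-primitive : ∀ i → Primitive (v i))
  (quotient : ∀ i → QuotientEdge r s (v i) (v (next i)))
  (convex : ∀ i j → j ≢ i → j ≢ next i → +0 ℤ.< det (v (next i) ⊖ v i) (v j ⊖ v i))
  where

  private instance
    r-nonZero : ℕ.NonZero r
    r-nonZero = ℕ.>-nonZero (ℕ.≤-trans (s≤s z≤n) s<r)

  f : Fin 5 → V
  f i = proj₁ (primitive-dual {v i} (v-primitive i))

  f∙v : ∀ i → f i ∙ v i ≡ + 1
  f∙v i = proj₂ (primitive-dual {v i} (v-primitive i))

  -- v i + v (next (next i)) = a i ⋆ v (next i), and f (next i) reads off the coefficient
  α β a : Fin 5 → ℤ
  α i = f i ∙ v (next i)
  β i = f (next i) ∙ v i
  a i = β i + α (next i)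

  det-next : ∀ i → det (v i) (v (next i)) ≡ + r
  det-next i = QuotientEdge.det≡r (quotient i)

  det-next² : ∀ i → det (v i) (v (next (next i))) ≡ + r * a i
  det-next² i = begin
    det x z                               ≡⟨ ℤ.*-identityʳ (det x z) ⟨
    det x z * + 1                         ≡⟨ cong (det x z *_) (f∙v (next i)) ⟨
    det x z * (f (next i) ∙ y)            ≡⟨ cramer (f (next i)) x y z ⟩
    det y z * β i + det x y * α (next i)  ≡⟨ cong₂ (λ p q → p * β i + q * α (next i))
                                                   (det-next (next i)) (det-next i) ⟩
    + r * β i + + r * α (next i)          ≡⟨ ℤ.*-distribˡ-+ (+ r) (β i) (α (next i)) ⟨
    + r * a i                             ∎
    where
    x = v i; y = v (next i); z = v (next (next i))

  det-next³-i : ∀ i → det (v (next (next (next i)))) (v i) ≡ + r * a (next (next (next i)))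
  det-next³-i i = subst (λ j → det (v i₃) (v j) ≡ + r * a i₃) (next⁵ i) (det-next² i₃)
    where
    i₃ = next (next (next i))

  frieze : Frieze a
  frieze i = ℤ.*-cancelˡ-≡ (+ r) _ _ (ℤ.*-cancelˡ-≡ (+ r) _ _ (begin
    + r * (+ r * (a₃ + a₀ * a₁))                ≡⟨ identity (+ r) a₀ a₁ a₃ ⟩
    (+ r * a₀) * (+ r * a₁) + (+ r * a₃) * + r  ≡⟨ cong₂ (λ p q → p + q * + r)
                                                     (cong₂ _*_ (det-next² i) (det-next² (next i)))
                                                     (det-next³-i i) ⟨
    det A C * det B E + det E A * + r           ≡⟨ cong (λ p → det A C * det B E + det E A * p)
                                                        (det-next (next i)) ⟨
    det A C * det B E + det E A * det B C       ≡⟨ plücker A B C E ⟨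
    det A B * det C E                           ≡⟨ cong₂ _*_ (det-next i) (det-next (next (next i))) ⟩
    + r * + r                                   ≡⟨ cong (+ r *_) (ℤ.*-identityʳ (+ r)) ⟨
    + r * (+ r * + 1)                           ∎))
    where
    A = v i; B = v (next i); C = v (next (next i)); E = v (next (next (next i)))
    a₀ = a i; a₁ = a (next i); a₃ = a (next (next (next i)))
    identity : ∀ r a₀ a₁ a₃ → r * (r * (a₃ + a₀ * a₁)) ≡ (r * a₀) * (r * a₁) + (r * a₃) * r
    identity = solve-∀

  upper : ∀ i → +0 ℤ.< + 2 - a i
  upper i = positive-factor r (begin
    + r * (+ 2 - a i)                  ≡⟨ identity (+ r) (a i) ⟩
    + r + + r + - (+ r * a i)          ≡⟨ cong₂ (λ p q → p + q + - (+ r * a i))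
                                                (det-next (next i)) (det-next i) ⟨
    det y z + det x y + - (+ r * a i)  ≡⟨ cong (λ p → det y z + det x y + - p) (det-next² i) ⟨
    det y z + det x y + - det x z      ≡⟨ cong (λ p → det y z + det x y + p) (det-antisym z x) ⟨
    det y z + det x y + det z x        ≡⟨ det-⊖ x y z ⟨
    det (y ⊖ x) (z ⊖ x)                ∎)
    (convex i (next (next i)) (next²≢id i) (next²≢next i))
    where
    x = v i; y = v (next i); z = v (next (next i))
    identity : ∀ r a → r * (+ 2 - a) ≡ r + r + - (r * a)
    identity = solve-∀

  lower : ∀ i → +0 ℤ.< a (next i) + + 1 + a (next (next (next i)))
  lower i = positive-factor r (begin
    + r * (a (next i) + + 1 + a₃)      ≡⟨ identity (+ r) (a (next i)) a₃ ⟩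
    + r * a (next i) + + r + + r * a₃  ≡⟨ cong₂ (λ p q → p + + r + q)
                                                (det-next² (next i)) (det-next³-i i) ⟨
    det y z + + r + det z x            ≡⟨ cong (λ p → det y z + p + det z x) (det-next i) ⟨
    det y z + det x y + det z x        ≡⟨ det-⊖ x y z ⟨
    det (y ⊖ x) (z ⊖ x)                ∎)
    (convex i (next (next (next i))) (next³≢id i) (next³≢next i))
    where
    x = v i; y = v (next i); z = v (next (next (next i)))
    a₃ = a (next (next (next i)))
    identity : ∀ r a₁ a₃ → r * (a₁ + + 1 + a₃) ≡ r * a₁ + r + r * a₃
    identity = solve-∀

  residues : ∀ i → ResiduePair r s (α i) (β i)
  residues i = quotientEdge-residues (f i) (f (next i)) (quotient i) (f∙v i) (f∙v (next i))

  r∣s²+1 : ∀ i → a i ≡ +0 → + r ∣ℤ + s * + s + + 1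
  r∣s²+1 i = residuePairs-cancel 1≤s s<r coprime (residues i) (residues (next i))

  r∣Σa : + r ∣ℤ + s * + s + + 1 → + r ∣ℤ Σ₅ a
  r∣Σa r∣s²+1 =
    subst (+ r ∣ℤ_) (sym (Σ₅-shift α β)) (Σ₅-∣ λ i → residuePair-sum r∣s²+1 (residues i))

  impossible : ⊥
  impossible with frieze-classification frieze upper lower
  ... | Σa≡3 , i , aᵢ≡0 =
    r∣3⇒r∤s²+1 1≤s s<r (subst (+ r ∣ℤ_) Σa≡3 (r∣Σa (r∣s²+1 i aᵢ≡0))) (r∣s²+1 i aᵢ≡0)

sum-map≡0 : ∀ {A : Set} (g : A → ℕ) xs → sum (map g xs) ≡ 0 → All (λ x → g x ≡ 0) xs
sum-map≡0 g []       _     = []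
sum-map≡0 g (x ∷ xs) sum≡0 = ℕ.m+n≡0⇒m≡0 (g x) sum≡0 ∷ sum-map≡0 g xs (ℕ.m+n≡0⇒n≡0 (g x) sum≡0)

length-edges : ∀ vs → length (edges vs) ≡ length vs
length-edges []       = refl
length-edges (v ∷ vs) = begin
  length (zipWith _,_ (v ∷ vs) (vs ++ [ v ]))  ≡⟨ List.length-zipWith _,_ (v ∷ vs) (vs ++ [ v ]) ⟩
  suc (length vs) ℕ.⊓ length (vs ++ [ v ])     ≡⟨ cong (suc (length vs) ℕ.⊓_) (List.length-++ vs) ⟩
  suc (length vs) ℕ.⊓ (length vs ℕ.+ 1)        ≡⟨ cong (suc (length vs) ℕ.⊓_) (ℕ.+-comm (length vs) 1) ⟩
  suc (length vs) ℕ.⊓ suc (length vs)          ≡⟨ ℕ.⊓-idem (suc (length vs)) ⟩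
  suc (length vs)                              ∎

edgeLength≢0 : ∀ e → OriginStrictlyLeft e → edgeLength e ≢ 0
edgeLength≢0 ((u₁ , u₂) , (w₁ , w₂)) det>0 ℓ≡0 = ℤ.<-irrefl (sym det≡0) det>0
  where
  w₁≡u₁ : w₁ ≡ u₁
  w₁≡u₁ = ℤ.i-j≡0⇒i≡j w₁ u₁ (ℤ.∣i∣≡0⇒i≡0 (gcd[m,n]≡0⇒m≡0 ℓ≡0))
  w₂≡u₂ : w₂ ≡ u₂
  w₂≡u₂ = ℤ.i-j≡0⇒i≡j w₂ u₂ (ℤ.∣i∣≡0⇒i≡0 (gcd[m,n]≡0⇒n≡0 ∣ w₁ - u₁ ∣ ℓ≡0))
  det≡0 : det (u₁ , u₂) (w₁ , w₂) ≡ +0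
  det≡0 = trans (cong₂ (λ p q → det (u₁ , u₂) (p , q)) w₁≡u₁ w₂≡u₂) (det-self (u₁ , u₂))

residue≡edgeLength : ∀ e → numT e ≡ 0 → residue e ≡ edgeLength e
residue≡edgeLength e numT≡0 with edgeHeight e
... | zero  = refl
... | suc h = begin
  ℓ % suc h                         ≡⟨ ℕ.+-identityʳ (ℓ % suc h) ⟨
  ℓ % suc h ℕ.+ 0                   ≡⟨ cong (λ n → ℓ % suc h ℕ.+ n ℕ.* suc h) numT≡0 ⟨
  ℓ % suc h ℕ.+ (ℓ / suc h) ℕ.* suc h ≡⟨ m≡m%n+[m/n]*n ℓ (suc h) ⟨
  ℓ                                 ∎
  where
  ℓ = edgeLength e

residue≢0 : ∀ e → numT e ≡ 0 → OriginStrictlyLeft e → residue e ≢ 0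
residue≢0 e numT≡0 det>0 ρ≡0 = edgeLength≢0 e det>0 (trans (sym (residue≡edgeLength e numT≡0)) ρ≡0)

residualCone-whole : ∀ u w → residue (u , w) ≡ edgeLength (u , w) →
                     proj₂ (residualCone (u , w)) ≡ + edgeLength (u , w) ⋆ w
residualCone-whole (u₁ , u₂) (w₁ , w₂) ρ≡ℓ =
  cong₂ _,_ (trans (cong (λ ρ → ℓ * u₁ + + ρ * (w₁ - u₁)) ρ≡ℓ) (identity ℓ u₁ w₁))
            (trans (cong (λ ρ → ℓ * u₂ + + ρ * (w₂ - u₂)) ρ≡ℓ) (identity ℓ u₂ w₂))
  where
  ℓ = + edgeLength ((u₁ , u₂) , (w₁ , w₂))
  identity : ∀ ℓ u w → ℓ * u + ℓ * (w - u) ≡ ℓ * w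
  identity = solve-∀

length-basketOf : ∀ es → All (λ e → residue e ≢ 0) es → length (basketOf es) ≡ length es
length-basketOf []       []           = refl
length-basketOf (e ∷ es) (ρ≢0 ∷ ρs≢0) with residue e
... | zero  = contradiction refl ρ≢0
... | suc _ = cong suc (length-basketOf es ρs≢0)

All-basketOf⁻ : ∀ {Q : V × V → Set} es → All (λ e → residue e ≢ 0) es →
                All Q (basketOf es) → All (Q ∘ residualCone) es
All-basketOf⁻ []       []           []  = []
All-basketOf⁻ (e ∷ es) (ρ≢0 ∷ ρs≢0) qs with residue e
... | zero  = contradiction refl ρ≢0
All-basketOf⁻ (e ∷ es) (ρ≢0 ∷ ρs≢0) (q ∷ qs) | suc _ = q ∷ All-basketOf⁻ es ρs≢0 qs

edge-quotient : ∀ {r s u w} → gcd r s ≡ 1 → Primitive u → Primitive w → OriginStrictlyLeft (u , w) →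
                numT (u , w) ≡ 0 → Represents u (proj₂ (residualCone (u , w))) r s → QuotientEdge r s u w
edge-quotient {r} {s} {u} {w} coprime u-primitive w-primitive det>0 numT≡0 represents =
  represents⇒quotientEdge {ℓ = edgeLength (u , w)} coprime u-primitive w-primitive det>0
    (subst (λ b → Represents u b r s)
           (residualCone-whole u w (residue≡edgeLength (u , w) numT≡0)) represents)

lookup-injective : ∀ {A : Set} {xs : List A} → Unique xs →
                   ∀ {i j} → i ≢ j → lookup xs i ≢ lookup xs j
lookup-injective {xs = _ ∷ _} _          {zero}  {zero}  0≢0 = contradiction refl 0≢0
lookup-injective {xs = _ ∷ _} (x∉ ∷ _)   {zero}  {suc j} _   = All.lookup x∉ (∈-lookup j)
lookup-injective {xs = _ ∷ _} (x∉ ∷ _)   {suc i} {zero}  _   = All.lookup x∉ (∈-lookup i) ∘ sym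
lookup-injective {xs = _ ∷ _} (_ ∷ uniq) {suc i} {suc j} i≢j = lookup-injective uniq (i≢j ∘ cong suc)

All-edges₅ : ∀ {Q : V × V → Set} {p₀ p₁ p₂ p₃ p₄} → let P = p₀ ∷ p₁ ∷ p₂ ∷ p₃ ∷ p₄ ∷ [] in
             All Q (edges P) → ∀ i → Q (lookup P i , lookup P (next i))
All-edges₅ (q ∷ _)                 zero                         = q
All-edges₅ (_ ∷ q ∷ _)             (suc zero)                   = q
All-edges₅ (_ ∷ _ ∷ q ∷ _)         (suc (suc zero))             = q
All-edges₅ (_ ∷ _ ∷ _ ∷ q ∷ _)     (suc (suc (suc zero)))       = q
All-edges₅ (_ ∷ _ ∷ _ ∷ _ ∷ q ∷ _) (suc (suc (suc (suc zero)))) = q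

fano-pentagon-impossible : ∀ {r s} P → length P ≡ 5 → 1 ≤ s → s < r → gcd r s ≡ 1 → IsFano P →
  All (λ e → numT e ≡ 0) (edges P) →
  All (λ e → Represents (proj₁ (residualCone e)) (proj₂ (residualCone e)) r s) (edges P) → ⊥
fano-pentagon-impossible []                          ()
fano-pentagon-impossible (_ ∷ [])                    ()
fano-pentagon-impossible (_ ∷ _ ∷ [])                ()
fano-pentagon-impossible (_ ∷ _ ∷ _ ∷ [])            ()
fano-pentagon-impossible (_ ∷ _ ∷ _ ∷ _ ∷ [])        ()
fano-pentagon-impossible (_ ∷ _ ∷ _ ∷ _ ∷ _ ∷ _ ∷ _) ()
fano-pentagon-impossible {r} {s} P@(_ ∷ _ ∷ _ ∷ _ ∷ _ ∷ []) refl
                         1≤s s<r coprime fano numT≡0 represents =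
  Pentagon.impossible 1≤s s<r coprime (lookup P) vertex-primitive quotient convex′
  where
  open IsFano fano
  vertex-primitive : ∀ i → Primitive (lookup P i)
  vertex-primitive i = All.lookup primitiveVerts (∈-lookup i)
  quotient : ∀ i → QuotientEdge r s (lookup P i) (lookup P (next i))
  quotient i = edge-quotient coprime (vertex-primitive i) (vertex-primitive (next i))
                 (All-edges₅ originInside i) (All-edges₅ numT≡0 i) (All-edges₅ represents i)
  convex′ : ∀ i j → j ≢ i → j ≢ next i →
            +0 ℤ.< det (lookup P (next i) ⊖ lookup P i) (lookup P j ⊖ lookup P i)
  convex′ i j j≢i j≢next = All-edges₅ convex i (lookup P j) (∈-lookup j)
                             (lookup-injective distinct j≢i) (lookup-injective distinct j≢next)

proposition4p6 : ¬ (Σ ℕ λ r → Σ ℕ λ s → Σ (List V) λ P →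
                    1 ≤ s × s < r × gcd r s ≡ 1 × IsFano P ×
                    proj₁ (SC P) ≡ 0 × CopiesOf 5 r s (proj₂ (SC P)))
proposition4p6 (r , s , P , 1≤s , s<r , coprime , fano , no-T-cones , five-cones , represents) =
  fano-pentagon-impossible P length≡5 1≤s s<r coprime fano numT≡0
    (All-basketOf⁻ (edges P) ρ≢0 represents)
  where
  numT≡0 : All (λ e → numT e ≡ 0) (edges P)
  numT≡0 = sum-map≡0 numT (edges P) no-T-cones
  ρ≢0 : All (λ e → residue e ≢ 0) (edges P)
  ρ≢0 = All.zipWith (λ {e} (t , o) → residue≢0 e t o) (numT≡0 , IsFano.originInside fano)
  length≡5 : length P ≡ 5
  length≡5 = trans (sym (length-edges P)) (trans (sym (length-basketOf (edges P) ρ≢0)) five-cones)
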